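{- Let $G$ be a finite nontrivial connected graph and let $f$ be a maximal irredundant broadcast on $G$. Then every vertex $u\in U_f$ satisfies $d(u,v)=f(v)+1$ for some vertex $v$ with $f(v)>0$.
   Context: A broadcast on $G=(V,E)$ is a function $f:V\to\{0,1,\dots,\operatorname{diam}(G)\}$ with $f(v)\le e(v)$ (the eccentricity of $v$) for all $v$. Let $V_f^+=\{v:f(v)>0\}$. A vertex $u$ is dominated by $f$ if $d(u,v)\le f(v)$ for some $v\in V_f^+$, and $U_f$ is the set of vertices not dominated by $f$. For $v\in V_f^+$, let $N_f[v]=\{u:d(u,v)\le f(v)\}$. The $f$-private boundary $\operatorname{PB}_f(v)$ is the set of $u\in N_f[v]$ not dominated by the broadcast obtained from $f$ by replacing $f(v)$ with $f(v)-1$, other values unchanged. The broadcast $f$ is irredundant if $\operatorname{PB}_f(v)\neq\varnothing$ for all $v\in V_f^+$. Write $g>f$ if $g(v)\ge f(v)$ for all $v$, with strict inequality for some $v$. An irredundant $f$ is maximal irredundant if no broadcast $g>f$ is irredundant. -}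

module Defs where

open import Data.Nat using (ℕ; zero; suc; _+_; _∸_; _≤_; _<_; _⊔_)
open import Data.Fin using (Fin; _≟_)
import Data.Fin as F
open import Data.Bool using (Bool; true; false; _∨_; _∧_; if_then_else_)
open import Data.Product using (Σ; ∃; _×_; _,_)
open import Relation.Nullary using (¬_; does)
open import Relation.Binary.PropositionalEquality using (_≡_)

record Graph : Set where
  field
    n     : ℕ
    adj   : Fin n → Fin n → Bool
    sym   : ∀ u v → adj u v ≡ adj v u
    irref : ∀ v → adj v v ≡ false
open Graph public

anyFin : ∀ {m} → (Fin m → Bool) → Bool
anyFin {zero}  p = false
anyFin {suc m} p = p F.zero ∨ anyFin (λ i → p (F.suc i))

maxFin : ∀ {m} → (Fin m → ℕ) → ℕ
maxFin {zero}  h = 0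
maxFin {suc m} h = h F.zero ⊔ maxFin (λ i → h (F.suc i))

reach : (G : Graph) → ℕ → Fin (n G) → Fin (n G) → Bool
reach G zero    u v = does (u ≟ v)
reach G (suc k) u v = reach G k u v ∨ anyFin (λ w → reach G k u w ∧ adj G w v)

-- least k in [i, i + fuel) with p k = true (returns i + fuel if none)
search : ℕ → ℕ → (ℕ → Bool) → ℕ
search zero       i p = i
search (suc fuel) i p = if p i then i else search fuel (suc i) p

-- Distance d(u,v): least k with a walk of length ≤ k from u to v.
-- (For a connected graph on n vertices it is < n, so searching k < n suffices.)
dist : (G : Graph) → Fin (n G) → Fin (n G) → ℕ
dist G u v = search (n G) 0 (λ k → reach G k u v)

Connected : Graph → Set
Connected G = ∀ u v → ∃ λ k → reach G k u v ≡ true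

ecc : (G : Graph) → Fin (n G) → ℕ
ecc G v = maxFin (λ u → dist G v u)

diam : Graph → ℕ
diam G = maxFin (ecc G)

-- f : V → ℕ is a broadcast iff f(v) ≤ e(v) for all v (this also gives f(v) ≤ diam G)
IsBroadcast : (G : Graph) → (Fin (n G) → ℕ) → Set
IsBroadcast G f = ∀ v → f v ≤ ecc G v

Dominated : (G : Graph) → (Fin (n G) → ℕ) → Fin (n G) → Set
Dominated G f u = ∃ λ v → (0 < f v) × (dist G u v ≤ f v)

decAt : (G : Graph) → (Fin (n G) → ℕ) → Fin (n G) → Fin (n G) → ℕ
decAt G f v w = if does (w ≟ v) then f v ∸ 1 else f w

InPB : (G : Graph) → (Fin (n G) → ℕ) → Fin (n G) → Fin (n G) → Set
InPB G f v u = (dist G u v ≤ f v) × ¬ Dominated G (decAt G f v) u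

Irredundant : (G : Graph) → (Fin (n G) → ℕ) → Set
Irredundant G f = ∀ v → 0 < f v → ∃ λ u → InPB G f v u

_>ᵇ_ : ∀ {m} → (Fin m → ℕ) → (Fin m → ℕ) → Set
g >ᵇ f = (∀ v → f v ≤ g v) × ∃ λ v → f v < g v

MaximalIrredundant : (G : Graph) → (Fin (n G) → ℕ) → Set
MaximalIrredundant G f =
  IsBroadcast G f × Irredundant G f ×
  (∀ g → IsBroadcast G g → g >ᵇ f → ¬ Irredundant G g)

-- If no vertex v with f(v) > 0 lies at distance exactly f(v) + 1 from the
-- undominated vertex u, raise f at u to 1. Then u is its own private boundary,
-- and every other broadcasting vertex v keeps a private boundary vertex w of f:
-- the new broadcast from u could only reach w if d(u,w) ≤ 1, and together with
-- f(v) < d(u,v) ≤ d(u,w) + d(w,v) ≤ 1 + f(v) this would force d(u,v) = f(v) + 1.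
-- So the raised broadcast is irredundant and strictly above f, contradicting
-- maximality.
module Submission where

open import Defs hiding (sym)
open import Data.Nat using (ℕ; zero; suc; _+_; _∸_; _≤_; _<_; z≤n; s≤s; _<?_)
import Data.Nat as ℕ
open import Data.Nat.Properties
  using (≤-refl; ≤-trans; ≤-antisym; ≤-<-trans; <⇒≤; ≮⇒≥; ≰⇒>; ≤∧≢⇒<; n≮n;
         n≢0⇒n>0; m≤m+n; m≤n+m; m≤m⊔n; m≤n⊔m; +-identityʳ; +-suc; +-comm; +-mono-≤; module ≤-Reasoning)
open import Data.Fin using (Fin; _≟_)
import Data.Fin as F
open import Data.Fin.Properties using (any?; toℕ<n)
open import Data.Bool using (Bool; true; false; _∨_; _∧_; if_then_else_)
open import Data.Product using (∃; _×_; _,_)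
open import Data.Sum using (_⊎_; inj₁; inj₂; [_,_]′)
open import Data.Empty using (⊥-elim)
open import Relation.Nullary using (¬_; Dec; yes; no; does)
open import Relation.Nullary.Decidable using (_×-dec_)
open import Relation.Binary.PropositionalEquality
  using (_≡_; _≢_; refl; sym; trans; subst; cong)

∨-trueˡ : ∀ {a b} → a ≡ true → a ∨ b ≡ true
∨-trueˡ refl = refl

∨-trueʳ : ∀ a {b} → b ≡ true → a ∨ b ≡ true
∨-trueʳ true  _ = refl
∨-trueʳ false e = e

∨-true⁻ : ∀ a {b} → a ∨ b ≡ true → a ≡ true ⊎ b ≡ true
∨-true⁻ true  _ = inj₁ refl
∨-true⁻ false e = inj₂ e

∧-true : ∀ {a b} → a ≡ true → b ≡ true → a ∧ b ≡ true
∧-true refl refl = refl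

∧-true⁻ : ∀ a {b} → a ∧ b ≡ true → a ≡ true × b ≡ true
∧-true⁻ true e = refl , e

anyFin-true : ∀ {m} (p : Fin m → Bool) x → p x ≡ true → anyFin p ≡ true
anyFin-true p F.zero    e = ∨-trueˡ e
anyFin-true p (F.suc x) e = ∨-trueʳ (p F.zero) (anyFin-true (λ i → p (F.suc i)) x e)

anyFin-true⁻ : ∀ {m} (p : Fin m → Bool) → anyFin p ≡ true → ∃ λ x → p x ≡ true
anyFin-true⁻ {suc m} p e with ∨-true⁻ (p F.zero) e
... | inj₁ e₀ = F.zero , e₀
... | inj₂ e₊ with anyFin-true⁻ (λ i → p (F.suc i)) e₊
...   | x , eₓ = F.suc x , eₓ

maxFin-≥ : ∀ {m} (h : Fin m → ℕ) x → h x ≤ maxFin h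
maxFin-≥ h F.zero    = m≤m⊔n _ _
maxFin-≥ h (F.suc x) = ≤-trans (maxFin-≥ (λ i → h (F.suc i)) x) (m≤n⊔m (h F.zero) _)

search-≤ : ∀ fuel i p → search fuel i p ≤ i + fuel
search-≤ zero       i p = m≤m+n i 0
search-≤ (suc fuel) i p with p i
... | true  = m≤m+n i _
... | false = subst (search fuel (suc i) p ≤_) (sym (+-suc i fuel)) (search-≤ fuel (suc i) p)

search-least : ∀ fuel i p k → i ≤ k → p k ≡ true → search fuel i p ≤ k
search-least zero       i p k i≤k _ = i≤k
search-least (suc fuel) i p k i≤k pk with p i in pi
... | true  = i≤k
... | false = search-least fuel (suc i) p k (≤∧≢⇒< i≤k i≢k) pk
  where
  i≢k : i ≢ k
  i≢k refl with trans (sym pi) pk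
  ... | ()

search-sound : ∀ fuel i p → search fuel i p < i + fuel → p (search fuel i p) ≡ true
search-sound zero       i p lt = ⊥-elim (n≮n i (subst (i <_) (+-identityʳ i) lt))
search-sound (suc fuel) i p lt with p i in pi
... | true  = pi
... | false = search-sound fuel (suc i) p (subst (search fuel (suc i) p <_) (+-suc i fuel) lt)

another : ∀ {m} → 2 ≤ m → (u : Fin m) → ∃ λ x → u ≢ x
another (s≤s (s≤s _)) F.zero    = F.suc F.zero , λ ()
another (s≤s (s≤s _)) (F.suc _) = F.zero , λ ()

update : ∀ {m} → (Fin m → ℕ) → Fin m → ℕ → Fin m → ℕ
update f v a w = if does (w ≟ v) then a else f w

module _ {m} (f : Fin m → ℕ) (v : Fin m) (a : ℕ) where

  update-same : update f v a v ≡ a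
  update-same with v ≟ v
  ... | yes _  = refl
  ... | no v≢v = ⊥-elim (v≢v refl)

  update-other : ∀ {w} → w ≢ v → update f v a w ≡ f w
  update-other {w} w≢v with w ≟ v
  ... | yes w≡v = ⊥-elim (w≢v w≡v)
  ... | no _    = refl

module _ {m} {f : Fin m → ℕ} {v : Fin m} {a : ℕ} where

  update->ᵇ : f v < a → update f v a >ᵇ f
  update->ᵇ fv<a = ≤-update , v , subst (f v <_) (sym (update-same f v a)) fv<a
    where
    ≤-update : ∀ w → f w ≤ update f v a w
    ≤-update w with w ≟ v
    ... | yes refl = <⇒≤ fv<a
    ... | no _     = ≤-refl

module _ (G : Graph) where

  private
    V : Set
    V = Fin (n G)

  reach-0⇒≡ : ∀ {u v : V} → reach G 0 u v ≡ true → u ≡ v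
  reach-0⇒≡ {u} {v} e with u ≟ v
  ... | yes u≡v = u≡v

  reach-refl : ∀ (v : V) → reach G 0 v v ≡ true
  reach-refl v with v ≟ v
  ... | yes _  = refl
  ... | no v≢v = ⊥-elim (v≢v refl)

  reach-++ : ∀ a b {u w v : V} →
             reach G a u w ≡ true → reach G b w v ≡ true → reach G (a + b) u v ≡ true
  reach-++ a zero {u} e₁ e₂ rewrite +-identityʳ a =
    subst (λ t → reach G a u t ≡ true) (reach-0⇒≡ e₂) e₁
  reach-++ a (suc b) {u} {w} {v} e₁ e₂ rewrite +-suc a b with ∨-true⁻ (reach G b w v) e₂
  ... | inj₁ wv = ∨-trueˡ (reach-++ a b e₁ wv)
  ... | inj₂ step with anyFin-true⁻ (λ y → reach G b w y ∧ adj G y v) step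
  ...   | y , wyv with ∧-true⁻ (reach G b w y) wyv
  ...     | wy , yv = ∨-trueʳ (reach G (a + b) u v)
              (anyFin-true (λ z → reach G (a + b) u z ∧ adj G z v) y (∧-true (reach-++ a b e₁ wy) yv))

  reach-sym : ∀ k {u v : V} → reach G k u v ≡ true → reach G k v u ≡ true
  reach-sym zero {u} {v} e = subst (λ t → reach G 0 t u ≡ true) (reach-0⇒≡ {u} {v} e) (reach-refl u)
  reach-sym (suc k) {u} {v} e with ∨-true⁻ (reach G k u v) e
  ... | inj₁ uv = ∨-trueˡ (reach-sym k uv)
  ... | inj₂ step with anyFin-true⁻ (λ y → reach G k u y ∧ adj G y v) step
  ...   | y , uyv with ∧-true⁻ (reach G k u y) uyv
  ...     | uy , yv = reach-++ 1 k vy (reach-sym k uy)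
    where
    vy : reach G 1 v y ≡ true
    vy = ∨-trueʳ (reach G 0 v y) (anyFin-true (λ z → reach G 0 v z ∧ adj G z y) v
           (∧-true (reach-refl v) (trans (Graph.sym G v y) yv)))

  dist-≤-n : ∀ (u v : V) → dist G u v ≤ n G
  dist-≤-n u v = search-≤ (n G) 0 _

  dist-reach : ∀ (u v : V) → dist G u v < n G → reach G (dist G u v) u v ≡ true
  dist-reach u v = search-sound (n G) 0 _

  dist-least : ∀ k (u v : V) → reach G k u v ≡ true → dist G u v ≤ k
  dist-least k u v = search-least (n G) 0 _ k z≤n

  dist-self : ∀ (u : V) → dist G u u ≡ 0
  dist-self u = ≤-antisym (dist-least 0 u u (reach-refl u)) z≤n

  ≢⇒dist-pos : ∀ {u v : V} → u ≢ v → 0 < dist G u v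
  ≢⇒dist-pos {u} {v} u≢v = n≢0⇒n>0 λ d≡0 →
    u≢v (reach-0⇒≡ (subst (λ k → reach G k u v ≡ true) d≡0
      (dist-reach u v (subst (_< n G) (sym d≡0) (≤-<-trans z≤n (toℕ<n u))))))

  -- For unreachable pairs `dist` is n G, which is at least every other distance.
  dist-sym : ∀ (u v : V) → dist G u v ≡ dist G v u
  dist-sym u v = ≤-antisym (≤-dist u v) (≤-dist v u)
    where
    ≤-dist : ∀ x y → dist G x y ≤ dist G y x
    ≤-dist x y with dist G y x <? n G
    ... | yes lt = dist-least _ x y (reach-sym (dist G y x) (dist-reach y x lt))
    ... | no ge  = ≤-trans (dist-≤-n x y) (≮⇒≥ ge)

  dist-triangle : ∀ (u w v : V) → dist G u v ≤ dist G u w + dist G w v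
  dist-triangle u w v with dist G u w <? n G | dist G w v <? n G
  ... | yes uw | yes wv = dist-least _ u v (reach-++ (dist G u w) (dist G w v) (dist-reach u w uw) (dist-reach w v wv))
  ... | no uw  | _      = ≤-trans (dist-≤-n u v) (≤-trans (≮⇒≥ uw) (m≤m+n _ _))
  ... | yes _  | no wv  = ≤-trans (dist-≤-n u v) (≤-trans (≮⇒≥ wv) (m≤n+m _ _))

  ecc-pos : 2 ≤ n G → ∀ (u : V) → 0 < ecc G u
  ecc-pos two u with another two u
  ... | x , u≢x = ≤-trans (≢⇒dist-pos u≢x) (maxFin-≥ (dist G u) x)

  update-broadcast : ∀ {f u a} → IsBroadcast G f → a ≤ ecc G u → IsBroadcast G (update f u a)
  update-broadcast {u = u} broadcast a≤ecc x with x ≟ u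
  ... | yes refl = a≤ecc
  ... | no _     = broadcast x

  Dominated-cong : ∀ {h h′} {w : V} → (∀ x → h x ≡ h′ x) → Dominated G h w → Dominated G h′ w
  Dominated-cong h≗h′ (x , pos , d) = x , subst (0 <_) (h≗h′ x) pos , subst (dist G _ x ≤_) (h≗h′ x) d

  Dominated-update : ∀ {h} {u w : V} {a} →
                     Dominated G (update h u a) w → Dominated G h w ⊎ dist G w u ≤ a
  Dominated-update {u = u} (x , pos , d) with x ≟ u
  ... | yes refl = inj₂ d
  ... | no _     = inj₁ (x , pos , d)

  undominated⇒zero : ∀ {f} {u : V} → ¬ Dominated G f u → f u ≡ 0
  undominated⇒zero {u = u} undom =
    ≤-antisym (≮⇒≥ λ pos → undom (u , pos , subst (_≤ _) (sym (dist-self u)) z≤n)) z≤n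

  undominated-far : ∀ {f} {u v : V} → ¬ Dominated G f u → 0 < f v → f v < dist G u v
  undominated-far {v = v} undom pos = ≰⇒> λ d≤fv → undom (v , pos , d≤fv)

  decAt-update : ∀ {f a} {u v : V} → v ≢ u →
                 ∀ x → decAt G (update f u a) v x ≡ update (decAt G f v) u a x
  decAt-update {f} {a} {u} {v} v≢u x with x ≟ v | x ≟ u
  ... | yes refl | yes refl = ⊥-elim (v≢u refl)
  ... | yes refl | no _     = cong (_∸ 1) (update-other f u a v≢u)
  ... | no _     | yes refl = refl
  ... | no _     | no _     = refl

  InPB-update : ∀ {f a} {u v w : V} → v ≢ u → ¬ dist G w u ≤ a →
                InPB G f v w → InPB G (update f u a) v w
  InPB-update {f} {a} {u} {w = w} v≢u far (wv , private-w) =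
    subst (dist G w _ ≤_) (sym (update-other f u a v≢u)) wv ,
    λ dom → [ private-w , far ]′ (Dominated-update (Dominated-cong (decAt-update v≢u) dom))

  InPB-raise-self : ∀ {f} {u : V} → ¬ Dominated G f u → InPB G (update f u 1) u u
  InPB-raise-self {f} {u} undom =
    subst (_≤ update f u 1 u) (sym (dist-self u)) z≤n , λ dom → undom (Dominated-cong lowered dom)
    where
    lowered : ∀ x → decAt G (update f u 1) u x ≡ f x
    lowered x with x ≟ u
    ... | yes refl = trans (cong (_∸ 1) (update-same f u 1)) (sym (undominated⇒zero undom))
    ... | no _     = refl

  undominated-next-to-ball : ∀ {f} {u v w : V} → ¬ Dominated G f u → 0 < f v →
                             dist G w v ≤ f v → dist G w u ≤ 1 → dist G u v ≡ f v + 1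
  undominated-next-to-ball {f} {u} {v} {w} undom pos wv wu = ≤-antisym
    (begin
      dist G u v              ≤⟨ dist-triangle u w v ⟩
      dist G u w + dist G w v ≤⟨ +-mono-≤ (subst (_≤ 1) (dist-sym w u) wu) wv ⟩
      1 + f v                 ≡⟨ +-comm 1 (f v) ⟩
      f v + 1                 ∎)
    (subst (_≤ dist G u v) (+-comm 1 (f v)) (undominated-far undom pos))
    where open ≤-Reasoning

  raise-irredundant : ∀ {f} {u : V} → Irredundant G f → ¬ Dominated G f u →
                      (∀ v → 0 < f v → dist G u v ≢ f v + 1) → Irredundant G (update f u 1)
  raise-irredundant {f} {u} irredundant undom no-outer v pos = at (v ≟ u)
    where
    at : Dec (v ≡ u) → ∃ (InPB G (update f u 1) v)
    at (yes refl) = u , InPB-raise-self undom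
    at (no v≢u)   = keep (irredundant v fv>0)
      where
      fv>0 : 0 < f v
      fv>0 = subst (0 <_) (update-other f u 1 v≢u) pos

      keep : ∃ (InPB G f v) → ∃ (InPB G (update f u 1) v)
      keep (w , pb@(wv , _)) =
        w , InPB-update v≢u (λ wu → no-outer v fv>0 (undominated-next-to-ball undom fv>0 wv wu)) pb

corollary3 : (G : Graph) → 2 ≤ n G → Connected G →
    (f : Fin (n G) → ℕ) → MaximalIrredundant G f →
    ∀ u → ¬ Dominated G f u →
    ∃ λ v → (0 < f v) × (dist G u v ≡ f v + 1)
corollary3 G two _ f (broadcast , irredundant , maximal) u undom
  with any? (λ v → (0 <? f v) ×-dec (dist G u v ℕ.≟ f v + 1))
... | yes outer   = outer
... | no no-outer = ⊥-elim (maximal (update f u 1)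
      (update-broadcast G broadcast (ecc-pos G two u))
      (update->ᵇ (subst (_< 1) (sym (undominated⇒zero G undom)) (s≤s z≤n)))
      (raise-irredundant G irredundant undom λ v pos d≡ → no-outer (v , pos , d≡)))
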